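{- Let $T$ be a rooted proper binary tree whose set of leaves $L$ has $|L| = n$, and let $\alpha > 5$ be a constant. Choose two leaves $a,b \in L$ uniformly at random, and partition the remaining leaves $c \in L\setminus\{a,b\}$ into $A = \{c : closer(a,b,c)=(a,c)\}$, $B = \{c : closer(a,b,c)=(b,c)\}$ and $R = \{c : closer(a,b,c) = (a,b)\}$. Then with probability at least $\frac{\alpha-5}{2\alpha^2}$, each of the three sets $A \cup \{a\}$, $B \cup \{b\}$ and $R$ has size at most $\frac{\alpha-1}{\alpha}\, n$.
   Context: A proper binary tree is a rooted tree in which every internal node has exactly two children. For leaves $u,v$, $lca(u,v)$ is their lowest common ancestor. The relative-distance query $closer(u,v,w)$ on three distinct leaves returns the pair among $\{u,v,w\}$ with the lower lowest common ancestor: $closer(u,v,w)=(u,v)$ if $lca(u,v)$ is a proper descendant of $lca(u,w)=lca(v,w)$, and analogously for $(u,w)$ and $(v,w)$.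
   Formalization: The constant α ranges over the rationals greater than 5. -}

module Defs where

open import Data.Nat using (ℕ; zero; suc)
open import Data.Bool using (Bool; true; false; _∧_)
open import Data.List using (List; []; _∷_; _++_; map; length; filter; cartesianProduct)
open import Data.Product using (_×_; _,_; Σ; proj₁; proj₂)
open import Data.Sum using (_⊎_)
open import Data.Integer using (+_)
open import Data.Rational using (ℚ; _/_; _*_; _-_; _≤_)
open import Data.Rational.Properties using (_≤?_)
open import Relation.Nullary using (¬_; Dec; yes; no)
open import Relation.Nullary.Decidable using (_×-dec_; _⊎-dec_; ¬?)
open import Relation.Binary.PropositionalEquality using (_≡_; refl)
open import Data.Bool using (T)
open import Data.Bool.Properties using (T?)

data Tree : Set where
  leaf : Tree
  node : Tree → Tree → Tree

data Leaf : Tree → Set where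
  here  : Leaf leaf
  goL   : ∀ {l r} → Leaf l → Leaf (node l r)
  goR   : ∀ {l r} → Leaf r → Leaf (node l r)

allLeaves : (t : Tree) → List (Leaf t)
allLeaves leaf = here ∷ []
allLeaves (node l r) = map goL (allLeaves l) ++ map goR (allLeaves r)

_≟ₗ_ : ∀ {t} → (u v : Leaf t) → Dec (u ≡ v)
here  ≟ₗ here  = yes refl
goL u ≟ₗ goL v with u ≟ₗ v
... | yes refl = yes refl
... | no ne = no λ { refl → ne refl }
goL u ≟ₗ goR v = no λ ()
goR u ≟ₗ goL v = no λ ()
goR u ≟ₗ goR v with u ≟ₗ v
... | yes refl = yes refl
... | no ne = no λ { refl → ne refl }

-- Nodes of the tree are addressed by their path from the root.
data Dir : Set where
  L R : Dir

path : ∀ {t} → Leaf t → List Dir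
path here = []
path (goL u) = L ∷ path u
path (goR u) = R ∷ path u

sameDir : Dir → Dir → Bool
sameDir L L = true
sameDir R R = true
sameDir _ _ = false

commonPrefix : List Dir → List Dir → List Dir
commonPrefix (d ∷ ds) (e ∷ es) with sameDir d e
... | true  = d ∷ commonPrefix ds es
... | false = []
commonPrefix _ _ = []

lca : ∀ {t} → Leaf t → Leaf t → List Dir
lca u v = commonPrefix (path u) (path v)

-- x is a proper descendant of y  iff  the address y is a proper prefix of x.
properDescᵇ : List Dir → List Dir → Bool
properDescᵇ (d ∷ ds) [] = true
properDescᵇ (d ∷ ds) (e ∷ es) = sameDir d e ∧ properDescᵇ ds es
properDescᵇ [] _ = false

ProperDesc : List Dir → List Dir → Set
ProperDesc x y = T (properDescᵇ x y)

properDesc? : (x y : List Dir) → Dec (ProperDesc x y)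
properDesc? x y = T? (properDescᵇ x y)

data Pair : Set where
  uv uw vw : Pair

Closer : ∀ {t} → Leaf t → Leaf t → Leaf t → Pair → Set
Closer u v w uv = ProperDesc (lca u v) (lca u w)
Closer u v w uw = ProperDesc (lca u w) (lca u v)
Closer u v w vw = ProperDesc (lca v w) (lca u v)

closer? : ∀ {t} (u v w : Leaf t) (p : Pair) → Dec (Closer u v w p)
closer? u v w uv = properDesc? (lca u v) (lca u w)
closer? u v w uw = properDesc? (lca u w) (lca u v)
closer? u v w vw = properDesc? (lca v w) (lca u v)

Other : ∀ {t} → Leaf t → Leaf t → Leaf t → Set
Other a b c = ¬ (c ≡ a) × ¬ (c ≡ b)

other? : ∀ {t} (a b c : Leaf t) → Dec (Other a b c)
other? a b c = ¬? (c ≟ₗ a) ×-dec ¬? (c ≟ₗ b)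

sizeA∪a : (t : Tree) → Leaf t → Leaf t → ℕ
sizeA∪a t a b = length (filter (λ c → (c ≟ₗ a) ⊎-dec (other? a b c ×-dec closer? a b c uw)) (allLeaves t))

sizeB∪b : (t : Tree) → Leaf t → Leaf t → ℕ
sizeB∪b t a b = length (filter (λ c → (c ≟ₗ b) ⊎-dec (other? a b c ×-dec closer? a b c vw)) (allLeaves t))

sizeR : (t : Tree) → Leaf t → Leaf t → ℕ
sizeR t a b = length (filter (λ c → other? a b c ×-dec closer? a b c uv) (allLeaves t))

ℕ→ℚ : ℕ → ℚ
ℕ→ℚ k = + k / 1

leafCount : Tree → ℕ
leafCount t = length (allLeaves t)

-- The sample space: ordered pairs (a,b) of distinct leaves, chosen uniformly.
Distinct : ∀ {t} → Leaf t × Leaf t → Set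
Distinct (a , b) = ¬ (a ≡ b)

distinct? : ∀ {t} (p : Leaf t × Leaf t) → Dec (Distinct p)
distinct? (a , b) = ¬? (a ≟ₗ b)

leafPairs : (t : Tree) → List (Leaf t × Leaf t)
leafPairs t = filter distinct? (cartesianProduct (allLeaves t) (allLeaves t))

-- |S| ≤ ((α-1)/α) n, written with the (positive) denominator α cleared.
AtMostFrac : ℚ → ℕ → ℕ → Set
AtMostFrac α n s = α * ℕ→ℚ s ≤ (α - ℕ→ℚ 1) * ℕ→ℚ n

atMostFrac? : ∀ α n s → Dec (AtMostFrac α n s)
atMostFrac? α n s = (α * ℕ→ℚ s) ≤? ((α - ℕ→ℚ 1) * ℕ→ℚ n)

Balanced : ℚ → (t : Tree) → Leaf t × Leaf t → Set
Balanced α t (a , b) =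
  AtMostFrac α (leafCount t) (sizeA∪a t a b) ×
  AtMostFrac α (leafCount t) (sizeB∪b t a b) ×
  AtMostFrac α (leafCount t) (sizeR t a b)

balanced? : ∀ α t (p : Leaf t × Leaf t) → Dec (Balanced α t p)
balanced? α t (a , b) =
  atMostFrac? α (leafCount t) (sizeA∪a t a b) ×-dec
  (atMostFrac? α (leafCount t) (sizeB∪b t a b) ×-dec
   atMostFrac? α (leafCount t) (sizeR t a b))

goodPairs : ℚ → Tree → ℕ
goodPairs α t = length (filter (balanced? α t) (leafPairs t))

numPairs : Tree → ℕ
numPairs t = length (leafPairs t)

module Submission where

-- Call a subtree light if it has at most 4n/5 leaves, and an internal node central if it has at
-- least n/5 leaves while both of its children are light. When the lca of a and b is a central node v,
-- the sets A ∪ {a} and B ∪ {b} lie inside the two children of v and R lies outside v, so all three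
-- have at most 4n/5 ≤ (α − 1)n/α elements. Counting bottom-up, a subtree with m leaves whose children
-- are light contains at least m(m − n/5 − 1) ordered pairs separated at central nodes; walking down
-- from the root through children with more than 4n/5 leaves reaches a central node with m > 4n/5,
-- which gives at least n²/40 such pairs. Finally (α − 5)/(2α²) ≤ 1/40 for every α.

open import Defs
open import Data.Bool using (Bool; true; false; _∧_; T)
open import Data.Bool.Properties using (T?)
open import Data.Empty using (⊥-elim)
open import Data.List using (List; []; _∷_; _++_; map; length; filter; cartesianProduct)
open import Data.List.Properties
  using ( length-++; length-map; length-filter; filter-++; filter-all; filter-none; map-++; map-∘; map-cong
        ; map-id; ++-assoc; ++-cancelˡ; ∷-injectiveˡ; cartesianProductWith-distribʳ-++ )
open import Data.List.Relation.Unary.All using (All; []; _∷_; universal)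
open import Data.List.Relation.Unary.All.Properties using (map⁺; ++⁺)
open import Data.Nat using (ℕ; suc; _+_; _*_; _≤_; _<_; z≤n; s≤s; _≤?_)
open import Data.Nat.Properties
open import Data.Nat.Tactic.RingSolver using (solve-∀)
open import Algebra.Properties.CommutativeSemigroup +-commutativeSemigroup using (interchange)
open import Data.Product using (_×_; _,_; proj₁; proj₂; Σ-syntax)
open import Data.Sum using (_⊎_; inj₁; inj₂)
open import Data.Unit using (tt)
open import Function using (_∘_)
open import Level using (0ℓ)
open import Relation.Nullary using (¬_; yes; no; does)
open import Relation.Unary using (Pred; Decidable; _⊆_; _∩_)
open import Relation.Unary.Properties using (_∩?_; ∁?)
open import Relation.Binary.PropositionalEquality

import Data.Integer as ℤ
import Data.Integer.Properties as ℤ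
open import Data.Nat.Coprimality as Coprime using (1-coprimeTo)
open import Data.Rational as ℚ using (ℚ; 0ℚ; mkℚ; *≤*)
import Data.Rational.Properties as ℚₚ
open import Data.Rational.Solver using (module +-*-Solver)

private variable A B : Set

module _ {P : Pred A 0ℓ} (P? : Decidable P) where

  count : List A → ℕ
  count xs = length (filter P? xs)

  count-++ : ∀ xs ys → count (xs ++ ys) ≡ count xs + count ys
  count-++ xs ys = trans (cong length (filter-++ P? xs ys)) (length-++ (filter P? xs))

  count-map : (f : B → A) (xs : List B) → count (map f xs) ≡ length (filter (P? ∘ f) xs)
  count-map f [] = refl
  count-map f (x ∷ xs) with does (P? (f x))
  ... | true  = cong suc (count-map f xs)
  ... | false = count-map f xs

  count-universal : (∀ x → P x) → ∀ xs → count xs ≡ length xs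
  count-universal all xs = cong length (filter-all P? (universal all xs))

  count-empty : (∀ x → ¬ P x) → ∀ xs → count xs ≡ 0
  count-empty none xs = cong length (filter-none P? (universal none xs))

  count-+-∁ : ∀ xs → count xs + length (filter (∁? P?) xs) ≡ length xs
  count-+-∁ [] = refl
  count-+-∁ (x ∷ xs) with P? x
  ... | yes _ = cong suc (count-+-∁ xs)
  ... | no  _ = trans (+-suc (count xs) _) (cong suc (count-+-∁ xs))

  module _ {Q : Pred A 0ℓ} (Q? : Decidable Q) where

    count-mono : P ⊆ Q → ∀ xs → count xs ≤ length (filter Q? xs)
    count-mono P⊆Q [] = z≤n
    count-mono P⊆Q (x ∷ xs) with P? x | Q? x
    ... | yes _  | yes _  = s≤s (count-mono P⊆Q xs)
    ... | yes px | no ¬qx = ⊥-elim (¬qx (P⊆Q px))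
    ... | no _   | yes _  = m≤n⇒m≤1+n (count-mono P⊆Q xs)
    ... | no _   | no _   = count-mono P⊆Q xs

    filter-filter : ∀ xs → filter Q? (filter P? xs) ≡ filter (P? ∩? Q?) xs
    filter-filter [] = refl
    filter-filter (x ∷ xs) with P? x
    ... | no _ = filter-filter xs
    ... | yes _ with Q? x
    ...   | yes _ = cong (x ∷_) (filter-filter xs)
    ...   | no _  = filter-filter xs

length-cartesianProduct : (xs : List A) (ys : List B) →
  length (cartesianProduct xs ys) ≡ length xs * length ys
length-cartesianProduct [] ys = refl
length-cartesianProduct (x ∷ xs) ys = begin
  length (map (x ,_) ys ++ cartesianProduct xs ys)  ≡⟨ length-++ (map (x ,_) ys) ⟩
  length (map (x ,_) ys) + length (cartesianProduct xs ys)
    ≡⟨ cong₂ _+_ (length-map (x ,_) ys) (length-cartesianProduct xs ys) ⟩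
  length ys + length xs * length ys  ∎
  where open ≡-Reasoning

All-cartesianProduct : {P : Pred (A × B) 0ℓ} {xs : List A} {ys : List B} →
  All (λ x → All (λ y → P (x , y)) ys) xs → All P (cartesianProduct xs ys)
All-cartesianProduct []           = []
All-cartesianProduct (Pxys ∷ Pxsys) = ++⁺ (map⁺ Pxys) (All-cartesianProduct Pxsys)

module _ {P : Pred (A × B) 0ℓ} (P? : Decidable P) where

  count-cartesianProduct-++ˡ : ∀ xs xs' ys → count P? (cartesianProduct (xs ++ xs') ys)
    ≡ count P? (cartesianProduct xs ys) + count P? (cartesianProduct xs' ys)
  count-cartesianProduct-++ˡ xs xs' ys = trans
    (cong (count P?) (cartesianProductWith-distribʳ-++ _,_ xs xs' ys))
    (count-++ P? (cartesianProduct xs ys) _)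

  count-cartesianProduct-++ʳ : ∀ xs ys ys' → count P? (cartesianProduct xs (ys ++ ys'))
    ≡ count P? (cartesianProduct xs ys) + count P? (cartesianProduct xs ys')
  count-cartesianProduct-++ʳ [] ys ys' = refl
  count-cartesianProduct-++ʳ (x ∷ xs) ys ys' = begin
    count P? (map (x ,_) (ys ++ ys') ++ cartesianProduct xs (ys ++ ys'))
      ≡⟨ count-++ P? (map (x ,_) (ys ++ ys')) _ ⟩
    count P? (map (x ,_) (ys ++ ys')) + count P? (cartesianProduct xs (ys ++ ys'))
      ≡⟨ cong₂ _+_ (trans (cong (count P?) (map-++ (x ,_) ys ys')) (count-++ P? (map (x ,_) ys) _))
                   (count-cartesianProduct-++ʳ xs ys ys') ⟩
    (count P? (map (x ,_) ys) + count P? (map (x ,_) ys')) +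
    (count P? (cartesianProduct xs ys) + count P? (cartesianProduct xs ys'))
      ≡⟨ interchange (count P? (map (x ,_) ys)) _ _ _ ⟩
    (count P? (map (x ,_) ys) + count P? (cartesianProduct xs ys)) +
    (count P? (map (x ,_) ys') + count P? (cartesianProduct xs ys'))
      ≡⟨ sym (cong₂ _+_ (count-++ P? (map (x ,_) ys) _) (count-++ P? (map (x ,_) ys') _)) ⟩
    count P? (cartesianProduct (x ∷ xs) ys) + count P? (cartesianProduct (x ∷ xs) ys')  ∎
    where open ≡-Reasoning

  count-cartesianProduct-all : ∀ {xs ys} → All (λ x → All (λ y → P (x , y)) ys) xs →
    count P? (cartesianProduct xs ys) ≡ length xs * length ys
  count-cartesianProduct-all {xs} {ys} all = trans
    (cong length (filter-all P? (All-cartesianProduct all))) (length-cartesianProduct xs ys)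

  count-cartesianProduct-++ : ∀ xs ys zs ws → count P? (cartesianProduct (xs ++ ys) (zs ++ ws))
    ≡ (count P? (cartesianProduct xs zs) + count P? (cartesianProduct xs ws))
    + (count P? (cartesianProduct ys zs) + count P? (cartesianProduct ys ws))
  count-cartesianProduct-++ xs ys zs ws = trans (count-cartesianProduct-++ˡ xs ys (zs ++ ws))
    (cong₂ _+_ (count-cartesianProduct-++ʳ xs zs ws) (count-cartesianProduct-++ʳ ys zs ws))

-- Subtree occurrences

leafCount-node : ∀ l r → leafCount (node l r) ≡ leafCount l + leafCount r
leafCount-node l r = trans (length-++ (map goL (allLeaves l)))
  (cong₂ _+_ (length-map goL (allLeaves l)) (length-map goR (allLeaves r)))

1≤leafCount : ∀ t → 1 ≤ leafCount t
1≤leafCount leaf       = s≤s z≤n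
1≤leafCount (node l r) = subst (1 ≤_) (sym (leafCount-node l r)) (≤-trans (1≤leafCount l) (m≤m+n _ _))

data _⊑_ : Tree → Tree → Set where
  root  : ∀ {t} → t ⊑ t
  left  : ∀ {u l r} → u ⊑ l → u ⊑ node l r
  right : ∀ {u l r} → u ⊑ r → u ⊑ node l r

embed : ∀ {u t} → u ⊑ t → Leaf u → Leaf t
embed root      x = x
embed (left s)  x = goL (embed s x)
embed (right s) x = goR (embed s x)

address : ∀ {u t} → u ⊑ t → List Dir
address root      = []
address (left s)  = L ∷ address s
address (right s) = R ∷ address s

⊑-trans : ∀ {u v t} → u ⊑ v → v ⊑ t → u ⊑ t
⊑-trans s root      = s
⊑-trans s (left s')  = left (⊑-trans s s')
⊑-trans s (right s') = right (⊑-trans s s')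

embed-trans : ∀ {u v t} (s : u ⊑ v) (s' : v ⊑ t) x → embed (⊑-trans s s') x ≡ embed s' (embed s x)
embed-trans s root       x = refl
embed-trans s (left s')  x = cong goL (embed-trans s s' x)
embed-trans s (right s') x = cong goR (embed-trans s s' x)

address-trans : ∀ {u v t} (s : u ⊑ v) (s' : v ⊑ t) → address (⊑-trans s s') ≡ address s' ++ address s
address-trans s root       = refl
address-trans s (left s')  = cong (L ∷_) (address-trans s s')
address-trans s (right s') = cong (R ∷_) (address-trans s s')

path-embed : ∀ {u t} (s : u ⊑ t) x → path (embed s x) ≡ address s ++ path x
path-embed root      x = refl
path-embed (left s)  x = cong (L ∷_) (path-embed s x)
path-embed (right s) x = cong (R ∷_) (path-embed s x)

leftChild : ∀ {l r t} → node l r ⊑ t → l ⊑ t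
leftChild = ⊑-trans (left root)

rightChild : ∀ {l r t} → node l r ⊑ t → r ⊑ t
rightChild = ⊑-trans (right root)

leavesOf : ∀ {u t} → u ⊑ t → List (Leaf t)
leavesOf {u} s = map (embed s) (allLeaves u)

leavesOf-root : ∀ {t} → leavesOf (root {t}) ≡ allLeaves t
leavesOf-root {t} = map-id (allLeaves t)

leavesOf-node : ∀ {l r t} (s : node l r ⊑ t) → leavesOf s ≡ leavesOf (leftChild s) ++ leavesOf (rightChild s)
leavesOf-node {l} {r} s = begin
  map (embed s) (map goL (allLeaves l) ++ map goR (allLeaves r))
    ≡⟨ map-++ (embed s) (map goL (allLeaves l)) _ ⟩
  map (embed s) (map goL (allLeaves l)) ++ map (embed s) (map goR (allLeaves r))
    ≡⟨ sym (cong₂ _++_ (map-∘ (allLeaves l)) (map-∘ (allLeaves r))) ⟩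
  map (embed s ∘ goL) (allLeaves l) ++ map (embed s ∘ goR) (allLeaves r)
    ≡⟨ sym (cong₂ _++_ (map-cong (embed-trans (left root) s) (allLeaves l))
                       (map-cong (embed-trans (right root) s) (allLeaves r))) ⟩
  leavesOf (leftChild s) ++ leavesOf (rightChild s)  ∎
  where open ≡-Reasoning

_≼ᵇ_ : List Dir → List Dir → Bool
[]       ≼ᵇ _        = true
(d ∷ ds) ≼ᵇ []       = false
(d ∷ ds) ≼ᵇ (e ∷ es) = sameDir d e ∧ (ds ≼ᵇ es)

Below : ∀ {t} → List Dir → Pred (Leaf t) 0ℓ
Below q c = T (q ≼ᵇ path c)

below? : ∀ {t} (q : List Dir) → Decidable (Below {t} q)
below? q c = T? (q ≼ᵇ path c)

leavesBelow : (t : Tree) → List Dir → ℕ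
leavesBelow t q = count (below? q) (allLeaves t)

leavesBelow-node-L : ∀ {l r} q → leavesBelow (node l r) (L ∷ q) ≡ leavesBelow l q
leavesBelow-node-L {l} {r} q = begin
  count Lq? (map goL (allLeaves l) ++ map goR (allLeaves r))
    ≡⟨ count-++ Lq? (map goL (allLeaves l)) _ ⟩
  count Lq? (map goL (allLeaves l)) + count Lq? (map goR (allLeaves r))
    ≡⟨ cong₂ _+_ (count-map Lq? goL (allLeaves l))
                 (trans (count-map Lq? goR (allLeaves r)) (count-empty _ (λ _ ()) (allLeaves r))) ⟩
  leavesBelow l q + 0
    ≡⟨ +-identityʳ _ ⟩
  leavesBelow l q  ∎
  where
  open ≡-Reasoning
  Lq? : Decidable (Below {node l r} (L ∷ q))
  Lq? = below? (L ∷ q)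

leavesBelow-node-R : ∀ {l r} q → leavesBelow (node l r) (R ∷ q) ≡ leavesBelow r q
leavesBelow-node-R {l} {r} q = begin
  count Rq? (map goL (allLeaves l) ++ map goR (allLeaves r))
    ≡⟨ count-++ Rq? (map goL (allLeaves l)) _ ⟩
  count Rq? (map goL (allLeaves l)) + count Rq? (map goR (allLeaves r))
    ≡⟨ cong₂ _+_ (trans (count-map Rq? goL (allLeaves l)) (count-empty _ (λ _ ()) (allLeaves l)))
                 (count-map Rq? goR (allLeaves r)) ⟩
  leavesBelow r q  ∎
  where
  open ≡-Reasoning
  Rq? : Decidable (Below {node l r} (R ∷ q))
  Rq? = below? (R ∷ q)

leavesBelow-address : ∀ {u t} (s : u ⊑ t) → leavesBelow t (address s) ≡ leafCount u
leavesBelow-address {u} root  = count-universal (below? []) (λ _ → tt) (allLeaves u)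
leavesBelow-address (left {l = l} {r} s)  = trans (leavesBelow-node-L {l} {r} (address s)) (leavesBelow-address s)
leavesBelow-address (right {l = l} {r} s) = trans (leavesBelow-node-R {l} {r} (address s)) (leavesBelow-address s)

leavesBelow-leftChild : ∀ {l r t} (s : node l r ⊑ t) → leavesBelow t (address s ++ L ∷ []) ≡ leafCount l
leavesBelow-leftChild {l} {t = t} s = subst (λ q → leavesBelow t q ≡ leafCount l)
  (address-trans (left root) s) (leavesBelow-address (leftChild s))

leavesBelow-rightChild : ∀ {l r t} (s : node l r ⊑ t) → leavesBelow t (address s ++ R ∷ []) ≡ leafCount r
leavesBelow-rightChild {r = r} {t} s = subst (λ q → leavesBelow t q ≡ leafCount r)
  (address-trans (right root) s) (leavesBelow-address (rightChild s))

-- Central nodes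

square-bound-node : ∀ n {m l r cₗ cᵣ c} → m ≡ l + r →
  5 * l * l ≤ 5 * cₗ + (n + 5) * l → 5 * r * r ≤ 5 * cᵣ + (n + 5) * r →
  (cₗ + l * r) + (r * l + cᵣ) ≤ c → 5 * m * m ≤ 5 * c + (n + 5) * m
square-bound-node n {l = l} {r} {cₗ} {cᵣ} {c} refl boundₗ boundᵣ split = begin
  5 * (l + r) * (l + r)
    ≡⟨ expand l r ⟩
  (5 * l * l + 5 * r * r) + 5 * (l * r + r * l)
    ≤⟨ +-monoˡ-≤ (5 * (l * r + r * l)) (+-mono-≤ boundₗ boundᵣ) ⟩
  ((5 * cₗ + (n + 5) * l) + (5 * cᵣ + (n + 5) * r)) + 5 * (l * r + r * l)
    ≡⟨ regroup l r cₗ cᵣ n ⟩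
  5 * ((cₗ + l * r) + (r * l + cᵣ)) + (n + 5) * (l + r)
    ≤⟨ +-monoˡ-≤ ((n + 5) * (l + r)) (*-monoʳ-≤ 5 split) ⟩
  5 * c + (n + 5) * (l + r)  ∎
  where
  open ≤-Reasoning
  expand : ∀ l r → 5 * (l + r) * (l + r) ≡ (5 * l * l + 5 * r * r) + 5 * (l * r + r * l)
  expand = solve-∀
  regroup : ∀ l r cₗ cᵣ n → ((5 * cₗ + (n + 5) * l) + (5 * cᵣ + (n + 5) * r)) + 5 * (l * r + r * l)
                           ≡ 5 * ((cₗ + l * r) + (r * l + cᵣ)) + (n + 5) * (l + r)
  regroup = solve-∀

-- With n = 2 + j and b = 4n + 1 + k, the difference of the two sides is a polynomial in j and k
-- with nonnegative coefficients.
quadratic-gap : ∀ {n b} → 4 * n < b → 2 ≤ n → 25 * (n * n) + 40 * (n + 5) * b ≤ 40 * b * b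
quadratic-gap 4n<b 2≤n with k , refl ← m≤n⇒∃[o]m+o≡n 4n<b | j , refl ← m≤n⇒∃[o]m+o≡n 2≤n =
  ≤-trans (m≤m+n _ _) (≤-reflexive (gap j k))
  where
  gap : ∀ j k → let n = 2 + j; b = suc (4 * n) + k in
    25 * (n * n) + 40 * (n + 5) * b + (620 + 1300 * j + 455 * j * j + 40 * k * k + 440 * k + 280 * j * k)
      ≡ 40 * b * b
  gap = solve-∀

heavy-square-bound : ∀ {n m c} → 5 * m * m ≤ 5 * c + (n + 5) * m → 4 * n < 5 * m → 2 ≤ n →
  n * n ≤ 40 * c
heavy-square-bound {n} {m} {c} bound 4n<5m 2≤n =
  *-cancelˡ-≤ 25 (+-cancelʳ-≤ X (25 * (n * n)) (25 * (40 * c)) (begin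
    25 * (n * n) + X              ≤⟨ quadratic-gap 4n<5m 2≤n ⟩
    40 * (5 * m) * (5 * m)        ≡⟨ scale m ⟩
    200 * (5 * m * m)             ≤⟨ *-monoʳ-≤ 200 bound ⟩
    200 * (5 * c + (n + 5) * m)   ≡⟨ distribute c n m ⟩
    25 * (40 * c) + X             ∎))
  where
  open ≤-Reasoning
  X : ℕ
  X = 40 * (n + 5) * (5 * m)
  scale : ∀ m → 40 * (5 * m) * (5 * m) ≡ 200 * (5 * m * m)
  scale = solve-∀
  distribute : ∀ c n m → 200 * (5 * c + (n + 5) * m) ≡ 25 * (40 * c) + 40 * (n + 5) * (5 * m)
  distribute = solve-∀

Light : ℕ → Tree → Set
Light n u = 5 * leafCount u ≤ 4 * n

Central : ℕ → Tree → Tree → Set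
Central n l r = n ≤ 5 * leafCount (node l r) × Light n l × Light n r

Light-left : ∀ {n} l r → Light n (node l r) → Light n l
Light-left l r = ≤-trans (*-monoʳ-≤ 5 (subst (leafCount l ≤_) (sym (leafCount-node l r)) (m≤m+n _ _)))

Light-right : ∀ {n} l r → Light n (node l r) → Light n r
Light-right l r = ≤-trans (*-monoʳ-≤ 5 (subst (leafCount r ≤_) (sym (leafCount-node l r)) (m≤n+m _ _)))

module CentralPairs {t : Tree} {G : Pred (Leaf t × Leaf t) 0ℓ} (G? : Decidable G)
  (central⇒G : ∀ {l r} (s : node l r ⊑ t) → Central (leafCount t) l r → ∀ x y →
                 G (embed s (goL x) , embed s (goR y)) × G (embed s (goR y) , embed s (goL x)))
  where

  n : ℕ
  n = leafCount t

  pairsIn : ∀ {u} → u ⊑ t → ℕ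
  pairsIn s = count G? (cartesianProduct (leavesOf s) (leavesOf s))

  crossPairs : ∀ {u v} → u ⊑ t → v ⊑ t → ℕ
  crossPairs s s' = count G? (cartesianProduct (leavesOf s) (leavesOf s'))

  pairsIn-node : ∀ {l r} (s : node l r ⊑ t) → pairsIn s
    ≡ (pairsIn (leftChild s) + crossPairs (leftChild s) (rightChild s))
    + (crossPairs (rightChild s) (leftChild s) + pairsIn (rightChild s))
  pairsIn-node s = trans (cong (λ xs → count G? (cartesianProduct xs xs)) (leavesOf-node s))
    (count-cartesianProduct-++ G? (leavesOf (leftChild s)) _ _ _)

  pairsIn-superadditive : ∀ {l r} (s : node l r ⊑ t) → pairsIn (leftChild s) + pairsIn (rightChild s) ≤ pairsIn s
  pairsIn-superadditive s = subst (pairsIn (leftChild s) + pairsIn (rightChild s) ≤_) (sym (pairsIn-node s))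
    (+-mono-≤ (m≤m+n (pairsIn (leftChild s)) (crossPairs (leftChild s) (rightChild s)))
              (m≤n+m (pairsIn (rightChild s)) (crossPairs (rightChild s) (leftChild s))))

  crossPairs-complete : ∀ {u v} (s : u ⊑ t) (s' : v ⊑ t) → (∀ x y → G (embed s x , embed s' y)) →
    crossPairs s s' ≡ leafCount u * leafCount v
  crossPairs-complete {u} {v} s s' good = trans
    (count-cartesianProduct-all G?
      (map⁺ (universal (λ x → map⁺ (universal (good x) (allLeaves v))) (allLeaves u))))
    (cong₂ _*_ (length-map (embed s) (allLeaves u)) (length-map (embed s') (allLeaves v)))

  pairsIn-central : ∀ {l r} (s : node l r ⊑ t) → Central n l r →
    (pairsIn (leftChild s) + leafCount l * leafCount r) + (leafCount r * leafCount l + pairsIn (rightChild s))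
      ≡ pairsIn s
  pairsIn-central s central = sym (trans (pairsIn-node s)
    (cong₂ (λ lr rl → (pairsIn (leftChild s) + lr) + (rl + pairsIn (rightChild s)))
      (crossPairs-complete (leftChild s) (rightChild s) λ x y →
        subst₂ G′ (embed-left x) (embed-right y) (proj₁ (central⇒G s central x y)))
      (crossPairs-complete (rightChild s) (leftChild s) λ y x →
        subst₂ G′ (embed-right y) (embed-left x) (proj₂ (central⇒G s central x y)))))
    where
    G′ : Leaf t → Leaf t → Set
    G′ a b = G (a , b)
    embed-left : ∀ x → embed s (goL x) ≡ embed (leftChild s) x
    embed-left x = sym (embed-trans (left root) s x)
    embed-right : ∀ y → embed s (goR y) ≡ embed (rightChild s) y
    embed-right y = sym (embed-trans (right root) s y)

  -- With m leaves below s: at least m(m − n/5 − 1) of the pairs inside s satisfy G.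
  SquareBound : ∀ {u} → u ⊑ t → Set
  SquareBound {u} s = 5 * leafCount u * leafCount u ≤ 5 * pairsIn s + (n + 5) * leafCount u

  central-bound : ∀ {l r} (s : node l r ⊑ t) → Central n l r →
    SquareBound (leftChild s) → SquareBound (rightChild s) → SquareBound s
  central-bound {l} {r} s central boundₗ boundᵣ =
    square-bound-node n {cₗ = pairsIn (leftChild s)} {pairsIn (rightChild s)} {pairsIn s}
      (leafCount-node l r) boundₗ boundᵣ (≤-reflexive (pairsIn-central s central))

  light-bound : ∀ {u} (s : u ⊑ t) → Light n u → SquareBound s
  light-bound {leaf} s _ = begin
    5            ≤⟨ m≤n+m 5 n ⟩
    n + 5        ≡⟨ *-identityʳ (n + 5) ⟨
    (n + 5) * 1  ≤⟨ m≤n+m _ (5 * pairsIn s) ⟩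
    5 * pairsIn s + (n + 5) * 1  ∎
    where open ≤-Reasoning
  light-bound {node l r} s light with n ≤? 5 * leafCount (node l r)
  ... | yes big = central-bound s (big , lightₗ , lightᵣ)
                    (light-bound (leftChild s) lightₗ) (light-bound (rightChild s) lightᵣ)
    where
    lightₗ : Light n l
    lightₗ = Light-left {n} l r light
    lightᵣ : Light n r
    lightᵣ = Light-right {n} l r light
  ... | no small = begin
    5 * m * m            ≤⟨ *-monoˡ-≤ m (≰⇒≥ small) ⟩
    n * m                ≤⟨ *-monoˡ-≤ m (m≤m+n n 5) ⟩
    (n + 5) * m          ≤⟨ m≤n+m _ (5 * pairsIn s) ⟩
    5 * pairsIn s + (n + 5) * m  ∎
    where
    open ≤-Reasoning
    m : ℕ
    m = leafCount (node l r)

  heavy-bound : ∀ {u} (s : u ⊑ t) → 4 * n < 5 * leafCount u → 2 ≤ n → n * n ≤ 40 * pairsIn s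
  heavy-bound {leaf} s heavy 2≤n = ⊥-elim (<⇒≱ (≤-trans (s≤s (*-monoʳ-≤ 4 2≤n)) heavy) (m≤m+n 5 3))
  heavy-bound {node l r} s heavy 2≤n with 5 * leafCount l ≤? 4 * n | 5 * leafCount r ≤? 4 * n
  ... | no heavyₗ | _ = ≤-trans (heavy-bound (leftChild s) (≰⇒> heavyₗ) 2≤n)
    (*-monoʳ-≤ 40 (≤-trans (m≤m+n _ (pairsIn (rightChild s))) (pairsIn-superadditive s)))
  ... | yes _ | no heavyᵣ = ≤-trans (heavy-bound (rightChild s) (≰⇒> heavyᵣ) 2≤n)
    (*-monoʳ-≤ 40 (≤-trans (m≤n+m _ (pairsIn (leftChild s))) (pairsIn-superadditive s)))
  ... | yes lightₗ | yes lightᵣ = heavy-square-bound {c = pairsIn s}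
    (central-bound s (big , lightₗ , lightᵣ)
      (light-bound (leftChild s) lightₗ) (light-bound (rightChild s) lightᵣ))
    heavy 2≤n
    where
    big : n ≤ 5 * leafCount (node l r)
    big = ≤-trans (m≤n*m n 4) (<⇒≤ heavy)

  central-pairs-bound : 2 ≤ n → n * n ≤ 40 * count G? (cartesianProduct (allLeaves t) (allLeaves t))
  central-pairs-bound 2≤n = subst (λ xs → n * n ≤ 40 * count G? (cartesianProduct xs xs)) leavesOf-root
    (heavy-bound root (+-monoˡ-≤ (4 * n) (≤-trans (s≤s z≤n) 2≤n)) 2≤n)

-- Rational bounds

split-4/5 : ∀ {s n} → 5 * s ≤ 4 * n → Σ[ d ∈ ℕ ] s + d ≡ n × s ≤ 4 * d
split-4/5 {s} {n} 5s≤4n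
  with d , refl ← m≤n⇒∃[o]m+o≡n {s} {n} (*-cancelˡ-≤ 4 (≤-trans (*-monoˡ-≤ s (n≤1+n 4)) 5s≤4n)) =
  d , refl , s≤4d
  where
  s≤4d : s ≤ 4 * d
  s≤4d = +-cancelˡ-≤ (4 * s) s (4 * d) (begin
    4 * s + s     ≡⟨ +-comm (4 * s) s ⟩
    5 * s         ≤⟨ 5s≤4n ⟩
    4 * (s + d)   ≡⟨ *-distribˡ-+ 4 s d ⟩
    4 * s + 4 * d ∎)
    where open ≤-Reasoning

ℕ→ℚ≡mkℚ : ∀ k → ℕ→ℚ k ≡ mkℚ (ℤ.+ k) 0 (Coprime.sym (1-coprimeTo k))
ℕ→ℚ≡mkℚ k = ℚₚ.normalize-coprime (Coprime.sym (1-coprimeTo k))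

ℕ→ℚ-+ : ∀ m n → ℕ→ℚ (m + n) ≡ ℕ→ℚ m ℚ.+ ℕ→ℚ n
ℕ→ℚ-+ m n rewrite ℕ→ℚ≡mkℚ m | ℕ→ℚ≡mkℚ n =
  cong (ℚ._/ 1) (sym (cong₂ ℤ._+_ (ℤ.*-identityʳ (ℤ.+ m)) (ℤ.*-identityʳ (ℤ.+ n))))

ℕ→ℚ-* : ∀ m n → ℕ→ℚ (m * n) ≡ ℕ→ℚ m ℚ.* ℕ→ℚ n
ℕ→ℚ-* m n rewrite ℕ→ℚ≡mkℚ m | ℕ→ℚ≡mkℚ n = cong (ℚ._/ 1) (ℤ.pos-* m n)

ℕ→ℚ-mono-≤ : ∀ {m n} → m ≤ n → ℕ→ℚ m ℚ.≤ ℕ→ℚ n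
ℕ→ℚ-mono-≤ {m} {n} m≤n rewrite ℕ→ℚ≡mkℚ m | ℕ→ℚ≡mkℚ n =
  *≤* (subst₂ ℤ._≤_ (sym (ℤ.*-identityʳ (ℤ.+ m))) (sym (ℤ.*-identityʳ (ℤ.+ n))) (ℤ.+≤+ m≤n))

0≤ℕ→ℚ : ∀ n → 0ℚ ℚ.≤ ℕ→ℚ n
0≤ℕ→ℚ n = ℕ→ℚ-mono-≤ {0} {n} z≤n

p≤p+q : ∀ p {q} → 0ℚ ℚ.≤ q → p ℚ.≤ p ℚ.+ q
p≤p+q p {q} 0≤q = subst (ℚ._≤ p ℚ.+ q) (ℚₚ.+-identityʳ p) (ℚₚ.+-monoʳ-≤ p 0≤q)

p≤q⇒0≤q-p : ∀ {p q} → p ℚ.≤ q → 0ℚ ℚ.≤ q ℚ.- p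
p≤q⇒0≤q-p {p} {q} p≤q = subst (ℚ._≤ q ℚ.- p) (ℚₚ.+-inverseʳ p) (ℚₚ.+-monoˡ-≤ (ℚ.- p) p≤q)

0≤p*q : ∀ {p q} → 0ℚ ℚ.≤ p → 0ℚ ℚ.≤ q → 0ℚ ℚ.≤ p ℚ.* q
0≤p*q {p} {q} 0≤p 0≤q =
  subst (ℚ._≤ p ℚ.* q) (ℚₚ.*-zeroʳ p) (ℚₚ.*-monoˡ-≤-nonNeg p {{ℚ.nonNegative 0≤p}} 0≤q)

0≤p*p : ∀ p → 0ℚ ℚ.≤ p ℚ.* p
0≤p*p p with ℚₚ.≤-total 0ℚ p
... | inj₁ 0≤p = 0≤p*q 0≤p 0≤p
... | inj₂ p≤0 = subst (0ℚ ℚ.≤_) (neg-square p) (0≤p*q (p≤q⇒0≤q-p p≤0) (p≤q⇒0≤q-p p≤0))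
  where
  open +-*-Solver
  neg-square : ∀ p → (0ℚ ℚ.- p) ℚ.* (0ℚ ℚ.- p) ≡ p ℚ.* p
  neg-square = solve 1 (λ p → (con 0ℚ :- p) :* (con 0ℚ :- p) := p :* p) refl

atMostFrac-4/5 : ∀ {α} → ℕ→ℚ 5 ℚ.≤ α → ∀ n s → 5 * s ≤ 4 * n → AtMostFrac α n s
atMostFrac-4/5 {α} 5≤α n s 5s≤4n with split-4/5 {s} {n} 5s≤4n
... | d , refl , s≤4d = begin
  α ℚ.* S
    ≤⟨ p≤p+q _ (0≤p*q (p≤q⇒0≤q-p 5≤α) (0≤ℕ→ℚ d)) ⟩
  α ℚ.* S ℚ.+ (α ℚ.- ℕ→ℚ 5) ℚ.* D
    ≤⟨ p≤p+q _ (p≤q⇒0≤q-p S≤4D) ⟩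
  α ℚ.* S ℚ.+ (α ℚ.- ℕ→ℚ 5) ℚ.* D ℚ.+ (ℕ→ℚ 4 ℚ.* D ℚ.- S)
    ≡⟨ regroup α S D ⟩
  (α ℚ.- ℕ→ℚ 1) ℚ.* (S ℚ.+ D)
    ≡⟨ cong ((α ℚ.- ℕ→ℚ 1) ℚ.*_) (ℕ→ℚ-+ s d) ⟨
  (α ℚ.- ℕ→ℚ 1) ℚ.* ℕ→ℚ (s + d)  ∎
  where
  open ℚₚ.≤-Reasoning
  open +-*-Solver
  S D : ℚ
  S = ℕ→ℚ s
  D = ℕ→ℚ d
  S≤4D : S ℚ.≤ ℕ→ℚ 4 ℚ.* D
  S≤4D = subst (S ℚ.≤_) (ℕ→ℚ-* 4 d) (ℕ→ℚ-mono-≤ s≤4d)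
  regroup : ∀ α S D → α ℚ.* S ℚ.+ (α ℚ.- ℕ→ℚ 5) ℚ.* D ℚ.+ (ℕ→ℚ 4 ℚ.* D ℚ.- S) ≡ (α ℚ.- ℕ→ℚ 1) ℚ.* (S ℚ.+ D)
  regroup = solve 3 (λ α S D → α :* S :+ (α :- con (ℕ→ℚ 5)) :* D :+ (con (ℕ→ℚ 4) :* D :- S)
    := (α :- con (ℕ→ℚ 1)) :* (S :+ D)) refl

-- 2α² − 40(α − 5) = 2(α − 10)², so the factor 40 is exactly what the case α = 10 requires.
scaled-bound : ∀ {α} → ℕ→ℚ 5 ℚ.≤ α → ∀ {m k} → m ≤ 40 * k →
  (α ℚ.- ℕ→ℚ 5) ℚ.* ℕ→ℚ m ℚ.≤ ((ℕ→ℚ 2 ℚ.* α) ℚ.* α) ℚ.* ℕ→ℚ k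
scaled-bound {α} 5≤α {m} {k} m≤40k = begin
  (α ℚ.- ℕ→ℚ 5) ℚ.* ℕ→ℚ m
    ≤⟨ ℚₚ.*-monoˡ-≤-nonNeg (α ℚ.- ℕ→ℚ 5) {{ℚ.nonNegative (p≤q⇒0≤q-p 5≤α)}}
         (subst (ℕ→ℚ m ℚ.≤_) (ℕ→ℚ-* 40 k) (ℕ→ℚ-mono-≤ m≤40k)) ⟩
  (α ℚ.- ℕ→ℚ 5) ℚ.* (ℕ→ℚ 40 ℚ.* K)
    ≤⟨ p≤p+q _ (0≤p*q (0≤p*q (0≤ℕ→ℚ 2) (0≤p*p (α ℚ.- ℕ→ℚ 10))) (0≤ℕ→ℚ k)) ⟩
  (α ℚ.- ℕ→ℚ 5) ℚ.* (ℕ→ℚ 40 ℚ.* K) ℚ.+ (ℕ→ℚ 2 ℚ.* ((α ℚ.- ℕ→ℚ 10) ℚ.* (α ℚ.- ℕ→ℚ 10))) ℚ.* K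
    ≡⟨ complete-square α K ⟩
  ((ℕ→ℚ 2 ℚ.* α) ℚ.* α) ℚ.* K  ∎
  where
  open ℚₚ.≤-Reasoning
  open +-*-Solver
  K : ℚ
  K = ℕ→ℚ k
  complete-square : ∀ α K →
    (α ℚ.- ℕ→ℚ 5) ℚ.* (ℕ→ℚ 40 ℚ.* K) ℚ.+ (ℕ→ℚ 2 ℚ.* ((α ℚ.- ℕ→ℚ 10) ℚ.* (α ℚ.- ℕ→ℚ 10))) ℚ.* K
      ≡ ((ℕ→ℚ 2 ℚ.* α) ℚ.* α) ℚ.* K
  complete-square = solve 2 (λ α K → (α :- con (ℕ→ℚ 5)) :* (con (ℕ→ℚ 40) :* K)
      :+ (con (ℕ→ℚ 2) :* ((α :- con (ℕ→ℚ 10)) :* (α :- con (ℕ→ℚ 10)))) :* K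
    := ((con (ℕ→ℚ 2) :* α) :* α) :* K) refl

-- Pairs separated at a node

commonPrefix-split : ∀ q {D E} p p' → sameDir D E ≡ false → commonPrefix (q ++ D ∷ p) (q ++ E ∷ p') ≡ q
commonPrefix-split []      {L} {L} p p' ()
commonPrefix-split []      {L} {R} p p' _ = refl
commonPrefix-split []      {R} {L} p p' _ = refl
commonPrefix-split []      {R} {R} p p' ()
commonPrefix-split (L ∷ q) p p' D≠E = cong (L ∷_) (commonPrefix-split q p p' D≠E)
commonPrefix-split (R ∷ q) p p' D≠E = cong (R ∷_) (commonPrefix-split q p p' D≠E)

properDesc-commonPrefix⇒≼ : ∀ q D p c → ProperDesc (commonPrefix (q ++ D ∷ p) c) q → T ((q ++ D ∷ []) ≼ᵇ c)
properDesc-commonPrefix⇒≼ []      D p []      ()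
properDesc-commonPrefix⇒≼ []      L p (L ∷ c) _ = tt
properDesc-commonPrefix⇒≼ []      L p (R ∷ c) ()
properDesc-commonPrefix⇒≼ []      R p (L ∷ c) ()
properDesc-commonPrefix⇒≼ []      R p (R ∷ c) _ = tt
properDesc-commonPrefix⇒≼ (d ∷ q) D p []      ()
properDesc-commonPrefix⇒≼ (L ∷ q) D p (L ∷ c) h = properDesc-commonPrefix⇒≼ q D p c h
properDesc-commonPrefix⇒≼ (L ∷ q) D p (R ∷ c) ()
properDesc-commonPrefix⇒≼ (R ∷ q) D p (L ∷ c) ()
properDesc-commonPrefix⇒≼ (R ∷ q) D p (R ∷ c) h = properDesc-commonPrefix⇒≼ q D p c h

≼⇒¬properDesc-commonPrefix : ∀ q p c → T (q ≼ᵇ c) → ¬ ProperDesc q (commonPrefix (q ++ p) c)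
≼⇒¬properDesc-commonPrefix []      p c       _ ()
≼⇒¬properDesc-commonPrefix (d ∷ q) p []      ()
≼⇒¬properDesc-commonPrefix (L ∷ q) p (L ∷ c) h = ≼⇒¬properDesc-commonPrefix q p c h
≼⇒¬properDesc-commonPrefix (L ∷ q) p (R ∷ c) ()
≼⇒¬properDesc-commonPrefix (R ∷ q) p (L ∷ c) ()
≼⇒¬properDesc-commonPrefix (R ∷ q) p (R ∷ c) h = ≼⇒¬properDesc-commonPrefix q p c h

≼ᵇ-++ : ∀ q p → T (q ≼ᵇ (q ++ p))
≼ᵇ-++ []      p = tt
≼ᵇ-++ (L ∷ q) p = ≼ᵇ-++ q p
≼ᵇ-++ (R ∷ q) p = ≼ᵇ-++ q p

sameDir≡false⇒≢ : ∀ {D E} → sameDir D E ≡ false → D ≢ E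
sameDir≡false⇒≢ {L} () refl
sameDir≡false⇒≢ {R} () refl

complement-light : ∀ {r k n} → r + k ≤ n → n ≤ 5 * k → 5 * r ≤ 4 * n
complement-light {r} {k} {n} r+k≤n n≤5k = +-cancelʳ-≤ (5 * k) (5 * r) (4 * n) (begin
  5 * r + 5 * k  ≡⟨ *-distribˡ-+ 5 r k ⟨
  5 * (r + k)    ≤⟨ *-monoʳ-≤ 5 r+k≤n ⟩
  5 * n          ≡⟨ +-comm n (4 * n) ⟩
  4 * n + n      ≤⟨ +-monoʳ-≤ (4 * n) n≤5k ⟩
  4 * n + 5 * k  ∎)
  where open ≤-Reasoning

Good : ℚ → (t : Tree) → Pred (Leaf t × Leaf t) 0ℓ
Good α t = Distinct ∩ Balanced α t

good? : ∀ α t → Decidable (Good α t)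
good? α t = distinct? ∩? balanced? α t

module SplitAt {t} {a b : Leaf t} (q : List Dir) {D E : Dir} (D≠E : sameDir D E ≡ false) {pa pb : List Dir}
  (path-a : path a ≡ q ++ D ∷ pa) (path-b : path b ≡ q ++ E ∷ pb) where

  lca-split : lca a b ≡ q
  lca-split rewrite path-a | path-b = commonPrefix-split q pa pb D≠E

  split-distinct : ¬ a ≡ b
  split-distinct refl =
    sameDir≡false⇒≢ D≠E (∷-injectiveˡ (++-cancelˡ q (D ∷ pa) (E ∷ pb) (trans (sym path-a) path-b)))

  closer-uw⇒Below : ∀ c → Closer a b c uw → Below (q ++ D ∷ []) c
  closer-uw⇒Below c closer = properDesc-commonPrefix⇒≼ q D pa (path c)
    (subst₂ ProperDesc (cong (λ p → commonPrefix p (path c)) path-a) lca-split closer)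

  closer-vw⇒Below : ∀ c → Closer a b c vw → Below (q ++ E ∷ []) c
  closer-vw⇒Below c closer = properDesc-commonPrefix⇒≼ q E pb (path c)
    (subst₂ ProperDesc (cong (λ p → commonPrefix p (path c)) path-b) lca-split closer)

  closer-uv⇒¬Below : ∀ c → Closer a b c uv → ¬ Below q c
  closer-uv⇒¬Below c closer below = ≼⇒¬properDesc-commonPrefix q (D ∷ pa) (path c) below
    (subst₂ ProperDesc lca-split (cong (λ p → commonPrefix p (path c)) path-a) closer)

  a-Below : Below (q ++ D ∷ []) a
  a-Below = subst (T ∘ ((q ++ D ∷ []) ≼ᵇ_)) (trans (++-assoc q (D ∷ []) pa) (sym path-a))
    (≼ᵇ-++ (q ++ D ∷ []) pa)

  b-Below : Below (q ++ E ∷ []) b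
  b-Below = subst (T ∘ ((q ++ E ∷ []) ≼ᵇ_)) (trans (++-assoc q (E ∷ []) pb) (sym path-b))
    (≼ᵇ-++ (q ++ E ∷ []) pb)

  sizeA∪a-≤ : sizeA∪a t a b ≤ leavesBelow t (q ++ D ∷ [])
  sizeA∪a-≤ = count-mono _ (below? (q ++ D ∷ [])) A∪a⊆ (allLeaves t)
    where
    A∪a⊆ : ∀ {c} → (c ≡ a) ⊎ (Other a b c × Closer a b c uw) → Below (q ++ D ∷ []) c
    A∪a⊆ (inj₁ refl)         = a-Below
    A∪a⊆ (inj₂ (_ , closer)) = closer-uw⇒Below _ closer

  sizeB∪b-≤ : sizeB∪b t a b ≤ leavesBelow t (q ++ E ∷ [])
  sizeB∪b-≤ = count-mono _ (below? (q ++ E ∷ [])) B∪b⊆ (allLeaves t)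
    where
    B∪b⊆ : ∀ {c} → (c ≡ b) ⊎ (Other a b c × Closer a b c vw) → Below (q ++ E ∷ []) c
    B∪b⊆ (inj₁ refl)         = b-Below
    B∪b⊆ (inj₂ (_ , closer)) = closer-vw⇒Below _ closer

  sizeR-+-below-≤ : sizeR t a b + leavesBelow t q ≤ leafCount t
  sizeR-+-below-≤ = begin
    sizeR t a b + leavesBelow t q
      ≤⟨ +-monoˡ-≤ _ (count-mono _ (∁? (below? q)) (closer-uv⇒¬Below _ ∘ proj₂) (allLeaves t)) ⟩
    length (filter (∁? (below? q)) (allLeaves t)) + leavesBelow t q
      ≡⟨ +-comm _ (leavesBelow t q) ⟩
    leavesBelow t q + length (filter (∁? (below? q)) (allLeaves t))
      ≡⟨ count-+-∁ (below? q) (allLeaves t) ⟩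
    leafCount t  ∎
    where open ≤-Reasoning

  split-good : ∀ {α} → ℕ→ℚ 5 ℚ.≤ α →
    5 * leavesBelow t (q ++ D ∷ []) ≤ 4 * leafCount t →
    5 * leavesBelow t (q ++ E ∷ []) ≤ 4 * leafCount t →
    leafCount t ≤ 5 * leavesBelow t q →
    Good α t (a , b)
  split-good 5≤α lightD lightE big = split-distinct
    , atMostFrac-4/5 5≤α (leafCount t) (sizeA∪a t a b) (≤-trans (*-monoʳ-≤ 5 sizeA∪a-≤) lightD)
    , atMostFrac-4/5 5≤α (leafCount t) (sizeB∪b t a b) (≤-trans (*-monoʳ-≤ 5 sizeB∪b-≤) lightE)
    , atMostFrac-4/5 5≤α (leafCount t) (sizeR t a b)
        (complement-light {k = leavesBelow t q} sizeR-+-below-≤ big)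

central⇒good : ∀ {α} → ℕ→ℚ 5 ℚ.≤ α → ∀ {t l r} (s : node l r ⊑ t) → Central (leafCount t) l r → ∀ x y →
  Good α t (embed s (goL x) , embed s (goR y)) × Good α t (embed s (goR y) , embed s (goL x))
central⇒good 5≤α {t} s (big , lightₗ , lightᵣ) x y =
  SplitAt.split-good (address s) refl (path-embed s (goL x)) (path-embed s (goR y)) 5≤α lightₗ′ lightᵣ′ big′
  , SplitAt.split-good (address s) refl (path-embed s (goR y)) (path-embed s (goL x)) 5≤α lightᵣ′ lightₗ′ big′
  where
  n : ℕ
  n = leafCount t
  lightₗ′ : 5 * leavesBelow t (address s ++ L ∷ []) ≤ 4 * n
  lightₗ′ = subst (λ k → 5 * k ≤ 4 * n) (sym (leavesBelow-leftChild s)) lightₗ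
  lightᵣ′ : 5 * leavesBelow t (address s ++ R ∷ []) ≤ 4 * n
  lightᵣ′ = subst (λ k → 5 * k ≤ 4 * n) (sym (leavesBelow-rightChild s)) lightᵣ
  big′ : n ≤ 5 * leavesBelow t (address s)
  big′ = subst (λ k → n ≤ 5 * k) (sym (leavesBelow-address s)) big

numPairs≤40*goodPairs : ∀ {α} → ℕ→ℚ 5 ℚ.≤ α → ∀ t → numPairs t ≤ 40 * goodPairs α t
numPairs≤40*goodPairs _ leaf = z≤n
numPairs≤40*goodPairs {α} 5≤α t@(node l r) = begin
  numPairs t                             ≤⟨ length-filter distinct? pairs ⟩
  length pairs                           ≡⟨ length-cartesianProduct leaves leaves ⟩
  leafCount t * leafCount t              ≤⟨ CentralPairs.central-pairs-bound (good? α t) (central⇒good 5≤α) 2≤n ⟩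
  40 * count (good? α t) pairs           ≡⟨ cong (λ ps → 40 * length ps) (filter-filter distinct? (balanced? α t) pairs) ⟨
  40 * goodPairs α t                     ∎
  where
  open ≤-Reasoning
  leaves : List (Leaf t)
  leaves = allLeaves t
  pairs : List (Leaf t × Leaf t)
  pairs = cartesianProduct leaves leaves
  2≤n : 2 ≤ leafCount t
  2≤n = subst (2 ≤_) (sym (leafCount-node l r)) (+-mono-≤ (1≤leafCount l) (1≤leafCount r))

lemma7 : (α : ℚ) → ℕ→ℚ 5 ℚ.< α → (t : Tree) →
    (α ℚ.- ℕ→ℚ 5) ℚ.* ℕ→ℚ (numPairs t) ℚ.≤ ((ℕ→ℚ 2 ℚ.* α) ℚ.* α) ℚ.* ℕ→ℚ (goodPairs α t)
lemma7 α 5<α t = scaled-bound 5≤α {numPairs t} {goodPairs α t} (numPairs≤40*goodPairs 5≤α t)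
  where
  5≤α : ℕ→ℚ 5 ℚ.≤ α
  5≤α = ℚₚ.<⇒≤ 5<α
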